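{- There is an infinite family $\mathcal{G}$ of connected split graphs such that every $G\in\mathcal{G}$ satisfies $\gamma_I^p(G)=|V(G)|$; in particular, the best constant $c$ such that $\gamma_I^p(G)\le c\,|V(G)|$ for all $G\in\mathcal{G}$ is $c=1$.
   Context: All graphs are finite, simple and undirected. A split graph is a graph whose vertex set can be partitioned into a clique and an independent set. For a graph $G=(V,E)$ and $v\in V$, $N(v)$ denotes the set of neighbours of $v$. A perfect Italian dominating function (PID-function) of $G$ is a function $f:V\to\{0,1,2\}$ such that for every vertex $v$ with $f(v)=0$ one has $\sum_{u\in N(v)} f(u)=2$. The weight of $f$ is $\sum_{v\in V} f(v)$. The perfect Italian domination number $\gamma_I^p(G)$ is the minimum weight of a PID-function of $G$. -}

module Defs where

open import Data.Nat using (ℕ; zero; suc; _+_; _≤_)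
open import Data.Fin using (Fin; zero; suc; toℕ)
open import Data.Bool using (Bool; true; false; if_then_else_)
open import Data.Product using (Σ; _×_; _,_)
open import Relation.Binary.PropositionalEquality using (_≡_; _≢_)

record Graph (n : ℕ) : Set where
  field
    adj    : Fin n → Fin n → Bool
    sym    : ∀ u v → adj u v ≡ adj v u
    irrefl : ∀ v → adj v v ≡ false
open Graph public

sumFin : (n : ℕ) → (Fin n → ℕ) → ℕ
sumFin zero    g = 0
sumFin (suc n) g = g zero + sumFin n (λ i → g (suc i))

data Reach {n : ℕ} (G : Graph n) : Fin n → Fin n → Set where
  here : ∀ {v} → Reach G v v
  step : ∀ {u v w} → adj G u v ≡ true → Reach G v w → Reach G u w

Connected : ∀ {n} → Graph n → Set
Connected {n} G = (u v : Fin n) → Reach G u v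

IsSplit : ∀ {n} → Graph n → Set
IsSplit {n} G = Σ (Fin n → Bool) λ inC →
  ((u v : Fin n) → inC u ≡ true → inC v ≡ true → u ≢ v → adj G u v ≡ true) ×
  ((u v : Fin n) → inC u ≡ false → inC v ≡ false → adj G u v ≡ false)

Fn : ℕ → Set
Fn n = Fin n → Fin 3

val : ∀ {n} → Fn n → Fin n → ℕ
val f v = toℕ (f v)

weight : ∀ {n} → Fn n → ℕ
weight {n} f = sumFin n (val f)

nbrSum : ∀ {n} → Graph n → Fn n → Fin n → ℕ
nbrSum {n} G f v = sumFin n (λ u → if adj G v u then val f u else 0)

IsPID : ∀ {n} → Graph n → Fn n → Set
IsPID {n} G f = (v : Fin n) → val f v ≡ 0 → nbrSum G f v ≡ 2

-- k is the perfect Italian domination number of G (minimum weight of a PID-function)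
IsPIDNumber : ∀ {n} → Graph n → ℕ → Set
IsPIDNumber {n} G k =
  (Σ (Fn n) λ f → IsPID G f × weight f ≡ k) ×
  ((f : Fn n) → IsPID G f → k ≤ weight f)

-- The witnesses are the thick spiders: a clique c₀,…,c_{k-1} and an independent set
-- s₀,…,s_{k-1} with s_i adjacent to c_j exactly when i ≠ j.  Writing C and S for the total
-- weight a PID-function f puts on the clique and on the legs, the conditions at c_i and s_i read
--   f(s_i) = 0 ⇒ C = 2 + f(c_i)   and   f(c_i) = 0 ⇒ C + S = 2 + f(s_i).
-- If f(c_j) = f(s_j) = 0 these force S = 0 and then C = 0, contradicting C = 2.  Otherwise
-- C + S ≥ k ≥ 5 > 2 + f(s_i), so no clique vertex has value 0, hence C ≥ k > 2 + f(c_i), so no leg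
-- has value 0 either.  Thus every PID-function is positive everywhere and weighs at least 2k,
-- which the constant function 1 attains.
module Submission where

open import Defs hiding (sym)
open import Data.Nat using (ℕ; zero; suc; _+_; _*_; _≤_; _<_; z≤n; s≤s)
open import Data.Nat.Properties
  using ( +-assoc; +-comm; +-identityʳ; *-identityʳ; *-zeroʳ; +-cancelˡ-≡; +-monoʳ-≤
        ; m+n≡0⇒m≡0; m+n≡0⇒n≡0; m≤m+n; m≤n+m; n≤0⇒n≡0; 0≢1+n
        ; ≤-reflexive; ≤-trans; ≤-<-trans; <⇒≱; +-commutativeSemigroup )
open import Data.Fin using (Fin; zero; suc; _↑ˡ_; _↑ʳ_; splitAt; join)
open import Data.Fin.Properties using (_≟_; splitAt-join; join-splitAt; toℕ≤pred[n])
open import Data.Bool using (Bool; true; false; if_then_else_; not)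
open import Data.Sum using (_⊎_; inj₁; inj₂)
open import Data.Product using (Σ; ∃; _×_; _,_)
open import Function using (_∘_)
open import Data.Empty using (⊥)
open import Relation.Nullary using (does; contradiction)
open import Relation.Nullary.Decidable using (map′; does-≡; dec-true; dec-false)
open import Relation.Binary.PropositionalEquality
  using (_≡_; _≢_; refl; sym; trans; cong; cong₂; subst; module ≡-Reasoning)
open import Algebra.Properties.CommutativeSemigroup +-commutativeSemigroup using (interchange)

sumFin-cong : ∀ n {g h : Fin n → ℕ} → (∀ i → g i ≡ h i) → sumFin n g ≡ sumFin n h
sumFin-cong zero    g≗h = refl
sumFin-cong (suc n) g≗h = cong₂ _+_ (g≗h zero) (sumFin-cong n (g≗h ∘ suc))

sumFin-const : ∀ n m → sumFin n (λ _ → m) ≡ n * m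
sumFin-const zero    m = refl
sumFin-const (suc n) m = cong (m +_) (sumFin-const n m)

sumFin-zero : ∀ n → sumFin n (λ _ → 0) ≡ 0
sumFin-zero n = trans (sumFin-const n 0) (*-zeroʳ n)

sumFin-split : ∀ m n (g : Fin (m + n) → ℕ) →
  sumFin (m + n) g ≡ sumFin m (g ∘ (_↑ˡ n)) + sumFin n (g ∘ (m ↑ʳ_))
sumFin-split zero    n g = refl
sumFin-split (suc m) n g =
  trans (cong (g zero +_) (sumFin-split m n (g ∘ suc))) (sym (+-assoc (g zero) _ _))

sumFin-distrib-+ : ∀ n (g h : Fin n → ℕ) → sumFin n (λ i → g i + h i) ≡ sumFin n g + sumFin n h
sumFin-distrib-+ zero    g h = refl
sumFin-distrib-+ (suc n) g h =
  trans (cong (g zero + h zero +_) (sumFin-distrib-+ n (g ∘ suc) (h ∘ suc)))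
        (interchange (g zero) (h zero) _ _)

term≤sumFin : ∀ n (g : Fin n → ℕ) i → g i ≤ sumFin n g
term≤sumFin (suc n) g zero    = m≤m+n (g zero) _
term≤sumFin (suc n) g (suc i) = ≤-trans (term≤sumFin n (g ∘ suc) i) (m≤n+m _ (g zero))

zero⊎length≤sumFin : ∀ n (g : Fin n → ℕ) → (∃ λ i → g i ≡ 0) ⊎ n ≤ sumFin n g
zero⊎length≤sumFin zero    g = inj₂ z≤n
zero⊎length≤sumFin (suc n) g with g zero in g0≡ | zero⊎length≤sumFin n (g ∘ suc)
... | zero  | _              = inj₁ (zero , g0≡)
... | suc _ | inj₁ (i , gi≡) = inj₁ (suc i , gi≡)
... | suc a | inj₂ n≤sum     = inj₂ (s≤s (≤-trans n≤sum (m≤n+m _ a)))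

sumFin<length⇒zero : ∀ n (g : Fin n → ℕ) → sumFin n g < n → ∃ λ i → g i ≡ 0
sumFin<length⇒zero n g sum<n with zero⊎length≤sumFin n g
... | inj₁ zero-at = zero-at
... | inj₂ n≤sum   = contradiction n≤sum (<⇒≱ sum<n)

nonzero⇒length≤sumFin : ∀ n (g : Fin n → ℕ) → (∀ i → g i ≢ 0) → n ≤ sumFin n g
nonzero⇒length≤sumFin n g g≢0 with zero⊎length≤sumFin n g
... | inj₁ (i , gi≡0) = contradiction gi≡0 (g≢0 i)
... | inj₂ n≤sum      = n≤sum

_≢ᵇ_ : ∀ {k} → Fin k → Fin k → Bool
i ≢ᵇ j = not (does (i ≟ j))

≢ᵇ-sym : ∀ {k} (i j : Fin k) → (i ≢ᵇ j) ≡ (j ≢ᵇ i)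
≢ᵇ-sym i j = cong not (does-≡ (i ≟ j) (map′ sym sym (j ≟ i)))

sumFinExcept : ∀ n → (Fin n → ℕ) → Fin n → ℕ
sumFinExcept n g i = sumFin n (λ j → if i ≢ᵇ j then g j else 0)

sumFinExcept+term : ∀ n (g : Fin n → ℕ) i → sumFinExcept n g i + g i ≡ sumFin n g
sumFinExcept+term (suc n) g zero    = +-comm (sumFin n (g ∘ suc)) (g zero)
sumFinExcept+term (suc n) g (suc i) =
  trans (+-assoc (g zero) (sumFinExcept n (g ∘ suc) i) (g (suc i)))
        (cong (g zero +_) (sumFinExcept+term n (g ∘ suc) i))

module _ {n} {G : Graph n} where

  Reach-trans : ∀ {u v w} → Reach G u v → Reach G v w → Reach G u w
  Reach-trans here         q = q
  Reach-trans (step uv p) q = step uv (Reach-trans p q)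

  Reach-sym : ∀ {u v} → Reach G u v → Reach G v u
  Reach-sym here        = here
  Reach-sym (step uv p) = Reach-trans (Reach-sym p) (step (trans (Graph.sym G _ _) uv) here)

  hub⇒connected : (h : Fin n) → (∀ v → Reach G v h) → Connected G
  hub⇒connected h to-h u v = Reach-trans (to-h u) (Reach-sym (to-h v))

module PIDArithmetic (k : ℕ) (5≤k : 5 ≤ k) (c s : Fin k → ℕ)
  (c≤2 : ∀ i → c i ≤ 2) (s≤2 : ∀ i → s i ≤ 2)
  (at-leg    : ∀ i → s i ≡ 0 → sumFin k c ≡ 2 + c i)
  (at-clique : ∀ i → c i ≡ 0 → sumFin k c + sumFin k s ≡ 2 + s i) where

  ¬bothZero : ∀ j → c j ≡ 0 → s j ≡ 0 → ⊥
  ¬bothZero j cj≡0 sj≡0 = 0≢1+n (trans (sym C≡0) C≡2)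
    where
    open ≡-Reasoning
    C≡2 : sumFin k c ≡ 2
    C≡2 = trans (at-leg j sj≡0) (cong (2 +_) cj≡0)
    S≡0 : sumFin k s ≡ 0
    S≡0 = +-cancelˡ-≡ 2 _ _ (begin
      2 + sumFin k s            ≡⟨ cong (_+ sumFin k s) C≡2 ⟨
      sumFin k c + sumFin k s   ≡⟨ at-clique j cj≡0 ⟩
      2 + s j                   ≡⟨ cong (2 +_) sj≡0 ⟩
      2 + 0                     ∎)
    c≡0 : ∀ i → c i ≡ 0
    c≡0 i = +-cancelˡ-≡ 2 _ _ (begin
      2 + c i     ≡⟨ at-leg i (n≤0⇒n≡0 (≤-trans (term≤sumFin k s i) (≤-reflexive S≡0))) ⟨
      sumFin k c  ≡⟨ C≡2 ⟩
      2 + 0       ∎)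
    C≡0 : sumFin k c ≡ 0
    C≡0 = trans (sumFin-cong k c≡0) (sumFin-zero k)

  c≢0 : ∀ i → c i ≢ 0
  c≢0 i ci≡0 =
    let j , cj+sj≡0 = sumFin<length⇒zero k (λ j → c j + s j) C+S<k
    in ¬bothZero j (m+n≡0⇒m≡0 (c j) cj+sj≡0) (m+n≡0⇒n≡0 (c j) cj+sj≡0)
    where
    C+S<k : sumFin k (λ j → c j + s j) < k
    C+S<k = ≤-<-trans (≤-trans (≤-reflexive (trans (sumFin-distrib-+ k c s) (at-clique i ci≡0)))
                               (+-monoʳ-≤ 2 (s≤2 i)))
                      5≤k

  s≢0 : ∀ i → s i ≢ 0
  s≢0 i si≡0 = let j , cj≡0 = sumFin<length⇒zero k c C<k in c≢0 j cj≡0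
    where
    C<k : sumFin k c < k
    C<k = ≤-<-trans (≤-trans (≤-reflexive (at-leg i si≡0)) (+-monoʳ-≤ 2 (c≤2 i))) 5≤k

module _ {k : ℕ} where

  spiderAdj : Fin k ⊎ Fin k → Fin k ⊎ Fin k → Bool
  spiderAdj (inj₁ i) (inj₁ j) = i ≢ᵇ j
  spiderAdj (inj₁ i) (inj₂ j) = i ≢ᵇ j
  spiderAdj (inj₂ i) (inj₁ j) = i ≢ᵇ j
  spiderAdj (inj₂ _) (inj₂ _) = false

  spiderAdj-sym : ∀ a b → spiderAdj a b ≡ spiderAdj b a
  spiderAdj-sym (inj₁ i) (inj₁ j) = ≢ᵇ-sym i j
  spiderAdj-sym (inj₁ i) (inj₂ j) = ≢ᵇ-sym i j
  spiderAdj-sym (inj₂ i) (inj₁ j) = ≢ᵇ-sym i j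
  spiderAdj-sym (inj₂ _) (inj₂ _) = refl

  spiderAdj-irrefl : ∀ a → spiderAdj a a ≡ false
  spiderAdj-irrefl (inj₁ i) = cong not (dec-true (i ≟ i) refl)
  spiderAdj-irrefl (inj₂ _) = refl

  inClique : Fin k ⊎ Fin k → Bool
  inClique (inj₁ _) = true
  inClique (inj₂ _) = false

  spiderAdj-clique : ∀ a b → inClique a ≡ true → inClique b ≡ true → a ≢ b → spiderAdj a b ≡ true
  spiderAdj-clique (inj₁ i) (inj₁ j) _ _ a≢b = cong not (dec-false (i ≟ j) (a≢b ∘ cong inj₁))

  spiderAdj-legs : ∀ a b → inClique a ≡ false → inClique b ≡ false → spiderAdj a b ≡ false
  spiderAdj-legs (inj₂ _) (inj₂ _) _ _ = refl

thickSpider : (k : ℕ) → Graph (k + k)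
thickSpider k = record
  { adj    = λ u v → spiderAdj (splitAt k u) (splitAt k v)
  ; sym    = λ u v → spiderAdj-sym (splitAt k u) (splitAt k v)
  ; irrefl = λ v → spiderAdj-irrefl (splitAt k v)
  }

thickSpider-adj : ∀ k a b → adj (thickSpider k) (join k k a) (join k k b) ≡ spiderAdj a b
thickSpider-adj k a b = cong₂ spiderAdj (splitAt-join k k a) (splitAt-join k k b)

thickSpider-split : ∀ k → IsSplit (thickSpider k)
thickSpider-split k =
    inClique ∘ splitAt k
  , (λ u v u∈C v∈C u≢v → spiderAdj-clique _ _ u∈C v∈C (u≢v ∘ splitAt-injective u v))
  , (λ u v u∉C v∉C → spiderAdj-legs _ _ u∉C v∉C)
  where
  splitAt-injective : ∀ u v → splitAt k u ≡ splitAt k v → u ≡ v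
  splitAt-injective u v eq =
    trans (sym (join-splitAt k k u)) (trans (cong (join k k) eq) (join-splitAt k k v))

thickSpider-connected : ∀ m → Connected (thickSpider (2 + m))
thickSpider-connected m = hub⇒connected hub (λ v →
  subst (λ w → Reach G w hub) (join-splitAt k k v) (to-hub (splitAt k v)))
  where
  k : ℕ
  k = 2 + m
  G : Graph (k + k)
  G = thickSpider k
  edge : ∀ a b → adj G (join k k a) (join k k b) ≡ spiderAdj a b
  edge = thickSpider-adj k
  hub : Fin (k + k)
  hub = join k k (inj₁ zero)
  to-hub : ∀ a → Reach G (join k k a) hub
  to-hub (inj₁ zero)    = here
  to-hub (inj₁ (suc i)) = step (edge (inj₁ (suc i)) (inj₁ zero)) here
  to-hub (inj₂ zero)    = step (edge (inj₂ zero) (inj₁ (suc zero))) (to-hub (inj₁ (suc zero)))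
  to-hub (inj₂ (suc i)) = step (edge (inj₂ (suc i)) (inj₁ zero)) here

module _ {k : ℕ} (f : Fn (k + k)) (pid : IsPID (thickSpider k) f) where

  private
    G : Graph (k + k)
    G = thickSpider k

    c s : Fin k → ℕ
    c i = val f (i ↑ˡ k)
    s i = val f (k ↑ʳ i)

    edge-term : ∀ a b (x : ℕ) →
      (if adj G (join k k a) (join k k b) then x else 0) ≡ (if spiderAdj a b then x else 0)
    edge-term a b x = cong (λ β → if β then x else 0) (thickSpider-adj k a b)

  nbrSum-clique : ∀ i → nbrSum G f (i ↑ˡ k) ≡ sumFinExcept k c i + sumFinExcept k s i
  nbrSum-clique i = trans (sumFin-split k k _) (cong₂ _+_
    (sumFin-cong k (λ j → edge-term (inj₁ i) (inj₁ j) (c j)))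
    (sumFin-cong k (λ j → edge-term (inj₁ i) (inj₂ j) (s j))))

  nbrSum-leg : ∀ i → nbrSum G f (k ↑ʳ i) ≡ sumFinExcept k c i
  nbrSum-leg i = trans (sumFin-split k k _) (trans (cong₂ _+_
    (sumFin-cong k (λ j → edge-term (inj₂ i) (inj₁ j) (c j)))
    (trans (sumFin-cong k (λ j → edge-term (inj₂ i) (inj₂ j) (s j))) (sumFin-zero k)))
    (+-identityʳ _))

  pid-at-leg : ∀ i → s i ≡ 0 → sumFin k c ≡ 2 + c i
  pid-at-leg i si≡0 = begin
    sumFin k c                ≡⟨ sumFinExcept+term k c i ⟨
    sumFinExcept k c i + c i  ≡⟨ cong (_+ c i) (trans (sym (nbrSum-leg i)) (pid (k ↑ʳ i) si≡0)) ⟩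
    2 + c i                   ∎
    where open ≡-Reasoning

  pid-at-clique : ∀ i → c i ≡ 0 → sumFin k c + sumFin k s ≡ 2 + s i
  pid-at-clique i ci≡0 = begin
    sumFin k c + sumFin k s
      ≡⟨ cong₂ _+_ (sumFinExcept+term k c i) (sumFinExcept+term k s i) ⟨
    (sumFinExcept k c i + c i) + (sumFinExcept k s i + s i)
      ≡⟨ interchange (sumFinExcept k c i) (c i) (sumFinExcept k s i) (s i) ⟩
    (sumFinExcept k c i + sumFinExcept k s i) + (c i + s i)
      ≡⟨ cong₂ _+_ (trans (sym (nbrSum-clique i)) (pid (i ↑ˡ k) ci≡0)) (cong (_+ s i) ci≡0) ⟩
    2 + s i
      ∎
    where open ≡-Reasoning

  thickSpider-PID-nowhereZero : 5 ≤ k → ∀ v → val f v ≢ 0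
  thickSpider-PID-nowhereZero 5≤k v =
    subst (λ w → val f w ≢ 0) (join-splitAt k k v) (nonzero (splitAt k v))
    where
    open PIDArithmetic k 5≤k c s (λ i → toℕ≤pred[n] (f (i ↑ˡ k))) (λ i → toℕ≤pred[n] (f (k ↑ʳ i)))
                       pid-at-leg pid-at-clique
    nonzero : ∀ a → val f (join k k a) ≢ 0
    nonzero (inj₁ i) = c≢0 i
    nonzero (inj₂ i) = s≢0 i

thickSpider-PIDNumber : ∀ k → 5 ≤ k → IsPIDNumber (thickSpider k) (k + k)
thickSpider-PIDNumber k 5≤k =
    (one , (λ _ ()) , trans (sumFin-const (k + k) 1) (*-identityʳ (k + k)))
  , (λ f pid → nonzero⇒length≤sumFin (k + k) (val f) (thickSpider-PID-nowhereZero f pid 5≤k))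
  where
  one : Fn (k + k)
  one _ = suc zero

theorem34 : (N : ℕ) → Σ ℕ λ n → N ≤ n × Σ (Graph n) λ G → Connected G × IsSplit G × IsPIDNumber G n
theorem34 N =
    k + k
  , ≤-trans (m≤n+m N 5) (m≤m+n k k)
  , thickSpider k
  , thickSpider-connected (3 + N)
  , thickSpider-split k
  , thickSpider-PIDNumber k (m≤m+n 5 N)
  where
  k : ℕ
  k = 5 + N
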